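{- Let $n$ be a positive integer and let $p$ and $r$ be distinct primes. If there are positive integers $a$ and $b$ such that $p^a$ divides $n$ and $r^b<n<p^a+r^b$, then for every integer $k$ with $0<k<n$, at least one of $p$ or $r$ divides $\binom{n}{k}$. -}

module Defs where

-- Suppose p ∤ C(n,k). From k·C(n,k) = n·C(n-1,k-1) and p^a ∣ n we get p^a ∣ k, and likewise
-- p^a ∣ n − k; hence p^a ≤ k and p^a ≤ n − k, which together with r^b < n < p^a + r^b place k
-- strictly between n − r^b and r^b. Since r divides C(r^b, i) for 0 < i < r^b, Pascal's rule
-- gives C(m + r^b, k) ≡ C(m, k) (mod r) for k < r^b; with m = n − r^b < k the right side is 0.
module Submission where

open import Defs
open import Data.Nat using (ℕ; _<_; _^_)
open import Data.Nat.Divisibility using (_∣_)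
open import Data.Nat.Primality using (Prime)
open import Data.Nat.Combinatorics using (_C_)
open import Data.Nat.Base using (_+_)
open import Data.Product using (_×_; ∃₂)
open import Data.Sum using (_⊎_)
open import Relation.Binary.PropositionalEquality using (_≢_)

open import Data.Nat.Base using (suc; zero; _*_; _∸_; _≤_; s≤s; z≤n; z<s; >-nonZero)
open import Data.Nat.Properties
open import Data.Nat.Divisibility
open import Data.Nat.DivMod using (_%_; %-distribˡ-+)
open import Data.Nat.Primality using (euclidsLemma; prime⇒nonZero)
open import Data.Nat.Combinatorics using (nC1≡n; nCk+nC[k+1]≡[n+1]C[k+1])
open import Data.Nat.Combinatorics.Specification using (k>n⇒nCk≡0)
open import Data.Product using (_,_)
open import Data.Sum using (inj₁; inj₂)
open import Relation.Nullary using (¬_; yes; no; contradiction)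
open import Relation.Binary.PropositionalEquality
  using (_≡_; refl; sym; trans; cong; cong₂; subst; module ≡-Reasoning)

[1+k]*[1+n]C[1+k]≡[1+n]*nCk : ∀ n k → suc k * (suc n C suc k) ≡ suc n * (n C k)
[1+k]*[1+n]C[1+k]≡[1+n]*nCk n zero = begin
  1 * (suc n C 1) ≡⟨ *-identityˡ (suc n C 1) ⟩
  suc n C 1       ≡⟨ nC1≡n (suc n) ⟩
  suc n           ≡⟨ *-identityʳ (suc n) ⟨
  suc n * 1       ∎
  where open ≡-Reasoning
[1+k]*[1+n]C[1+k]≡[1+n]*nCk zero (suc k) =
  trans (cong (suc (suc k) *_) (k>n⇒nCk≡0 {1} {suc (suc k)} (s≤s (s≤s z≤n)))) (*-zeroʳ (suc (suc k)))
[1+k]*[1+n]C[1+k]≡[1+n]*nCk (suc n) (suc k) = begin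
  suc (suc k) * (suc (suc n) C suc (suc k))
    ≡⟨ cong (suc (suc k) *_) (nCk+nC[k+1]≡[n+1]C[k+1] (suc n) (suc k)) ⟨
  suc (suc k) * (A + suc n C suc (suc k))
    ≡⟨ *-distribˡ-+ (suc (suc k)) A (suc n C suc (suc k)) ⟩
  (A + suc k * A) + suc (suc k) * (suc n C suc (suc k))
    ≡⟨ cong₂ (λ x y → (A + x) + y) ([1+k]*[1+n]C[1+k]≡[1+n]*nCk n k)
                                    ([1+k]*[1+n]C[1+k]≡[1+n]*nCk n (suc k)) ⟩
  (A + suc n * (n C k)) + suc n * (n C suc k)
    ≡⟨ +-assoc A (suc n * (n C k)) (suc n * (n C suc k)) ⟩
  A + (suc n * (n C k) + suc n * (n C suc k))
    ≡⟨ cong (A +_) (*-distribˡ-+ (suc n) (n C k) (n C suc k)) ⟨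
  A + suc n * (n C k + n C suc k)
    ≡⟨ cong (λ x → A + suc n * x) (nCk+nC[k+1]≡[n+1]C[k+1] n k) ⟩
  A + suc n * A ∎
  where
    open ≡-Reasoning
    A = suc n C suc k

prime^a∣m*n∧p∤n⇒p^a∣m : ∀ {p} → Prime p → ∀ a {m n} → p ^ a ∣ m * n → ¬ p ∣ n → p ^ a ∣ m
prime^a∣m*n∧p∤n⇒p^a∣m pp zero {m} _ _ = 1∣ m
prime^a∣m*n∧p∤n⇒p^a∣m {p} pp (suc a) {m} {n} p^[1+a]∣m*n p∤n
  with euclidsLemma m n pp (∣-trans (m∣m*n (p ^ a)) p^[1+a]∣m*n)
... | inj₂ p∣n = contradiction p∣n p∤n
... | inj₁ (divides q refl) =
  subst (p * p ^ a ∣_) (*-comm p q) (*-monoʳ-∣ p (prime^a∣m*n∧p∤n⇒p^a∣m pp a p^a∣q*n p∤n))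
  where
    instance _ = prime⇒nonZero pp
    p^a∣q*n : p ^ a ∣ q * n
    p^a∣q*n = *-cancelˡ-∣ p (subst (p * p ^ a ∣_)
      (trans (cong (_* n) (*-comm q p)) (*-assoc p q n)) p^[1+a]∣m*n)

p^a∣n∧p∤nCk⇒p^a∣k : ∀ {p} → Prime p → ∀ a {n k} → 0 < k →
                    p ^ a ∣ n → ¬ p ∣ n C k → p ^ a ∣ k
p^a∣n∧p∤nCk⇒p^a∣k pp a {zero} (s≤s z≤n) _ p∤0 = contradiction (_ ∣0) p∤0
p^a∣n∧p∤nCk⇒p^a∣k {p} pp a {suc n} {suc k} (s≤s z≤n) p^a∣n p∤nCk =
  prime^a∣m*n∧p∤n⇒p^a∣m pp a p^a∣k*nCk p∤nCk
  where
    p^a∣k*nCk : p ^ a ∣ suc k * (suc n C suc k)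
    p^a∣k*nCk = subst (p ^ a ∣_) (sym ([1+k]*[1+n]C[1+k]≡[1+n]*nCk n k))
                      (∣-trans p^a∣n (m∣m*n (n C k)))

p∣p^bCk : ∀ {p} → Prime p → ∀ b {k} → 0 < k → k < p ^ b → p ∣ (p ^ b) C k
p∣p^bCk {p} pp b {k} 0<k k<p^b with p ∣? (p ^ b) C k
... | yes p∣p^bCk = p∣p^bCk
... | no  p∤p^bCk = contradiction (∣⇒≤ {{>-nonZero 0<k}} p^b∣k) (<⇒≱ k<p^b)
  where p^b∣k = p^a∣n∧p∤nCk⇒p^a∣k pp b 0<k ∣-refl p∤p^bCk

module _ {p} (pp : Prime p) (b : ℕ) where
  instance _ = prime⇒nonZero pp

  0%p≡0 : 0 % p ≡ 0
  0%p≡0 = n∣m⇒m%n≡0 0 p (p ∣0)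

  [m+p^b]Ck%p≡mCk%p : ∀ m k → k < p ^ b → ((m + p ^ b) C k) % p ≡ (m C k) % p
  [m+p^b]Ck%p≡mCk%p zero    zero    _     = refl
  [m+p^b]Ck%p≡mCk%p zero    (suc k) k<p^b =
    trans (n∣m⇒m%n≡0 _ p (p∣p^bCk pp b z<s k<p^b)) (sym 0%p≡0)
  [m+p^b]Ck%p≡mCk%p (suc m) zero    _     = refl
  [m+p^b]Ck%p≡mCk%p (suc m) (suc k) k<p^b = begin
    (suc (m + p ^ b) C suc k) % p
      ≡⟨ cong (_% p) (nCk+nC[k+1]≡[n+1]C[k+1] (m + p ^ b) k) ⟨
    ((m + p ^ b) C k + (m + p ^ b) C suc k) % p
      ≡⟨ %-distribˡ-+ ((m + p ^ b) C k) ((m + p ^ b) C suc k) p ⟩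
    (((m + p ^ b) C k) % p + ((m + p ^ b) C suc k) % p) % p
      ≡⟨ cong₂ (λ x y → (x + y) % p) ([m+p^b]Ck%p≡mCk%p m k (<-trans (n<1+n k) k<p^b))
                                      ([m+p^b]Ck%p≡mCk%p m (suc k) k<p^b) ⟩
    ((m C k) % p + (m C suc k) % p) % p
      ≡⟨ %-distribˡ-+ (m C k) (m C suc k) p ⟨
    (m C k + m C suc k) % p
      ≡⟨ cong (_% p) (nCk+nC[k+1]≡[n+1]C[k+1] m k) ⟩
    (suc m C suc k) % p ∎
    where open ≡-Reasoning

  n∸p^b<k<p^b⇒p∣nCk : ∀ {n k} → p ^ b ≤ n → n ∸ p ^ b < k → k < p ^ b → p ∣ n C k
  n∸p^b<k<p^b⇒p∣nCk {n} {k} p^b≤n n∸p^b<k k<p^b = m%n≡0⇒n∣m (n C k) p (begin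
    (n C k) % p             ≡⟨ cong (λ x → (x C k) % p) (m∸n+n≡m p^b≤n) ⟨
    ((m + p ^ b) C k) % p   ≡⟨ [m+p^b]Ck%p≡mCk%p m k k<p^b ⟩
    (m C k) % p             ≡⟨ cong (_% p) (k>n⇒nCk≡0 n∸p^b<k) ⟩
    0 % p                   ≡⟨ 0%p≡0 ⟩
    0                       ∎)
    where
      open ≡-Reasoning
      m = n ∸ p ^ b

lemma4p3 : (n p r : ℕ) → 0 < n → Prime p → Prime r → p ≢ r →
    ∃₂ (λ a b → 0 < a × 0 < b × (p ^ a) ∣ n × (r ^ b) < n × n < p ^ a + r ^ b) →
    (k : ℕ) → 0 < k → k < n → (p ∣ n C k) ⊎ (r ∣ n C k)
lemma4p3 n p r _ pp rp _ (a , b , _ , _ , p^a∣n , r^b<n , n<p^a+r^b) k 0<k k<n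
  with p ∣? n C k
... | yes p∣nCk = inj₁ p∣nCk
... | no  p∤nCk = inj₂ (n∸p^b<k<p^b⇒p∣nCk rp b (<⇒≤ r^b<n) n∸r^b<k k<r^b)
  where
    instance _ = >-nonZero 0<k
    instance _ = >-nonZero (m<n⇒0<n∸m k<n)
    instance _ = m^n≢0 r b {{prime⇒nonZero rp}}
    k+[n∸k]≡n : k + (n ∸ k) ≡ n
    k+[n∸k]≡n = m+[n∸m]≡n (<⇒≤ k<n)
    p^a∣k : p ^ a ∣ k
    p^a∣k = p^a∣n∧p∤nCk⇒p^a∣k pp a 0<k p^a∣n p∤nCk
    p^a∣n∸k : p ^ a ∣ n ∸ k
    p^a∣n∸k = ∣m+n∣m⇒∣n (subst (p ^ a ∣_) (sym k+[n∸k]≡n) p^a∣n) p^a∣k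
    k+p^a≤n : k + p ^ a ≤ n
    k+p^a≤n = subst (k + p ^ a ≤_) k+[n∸k]≡n (+-monoʳ-≤ k (∣⇒≤ p^a∣n∸k))
    k<r^b : k < r ^ b
    k<r^b = ≤-<-trans (m+n≤o⇒m≤o∸n k k+p^a≤n) (m<n+o⇒m∸n<o n (p ^ a) n<p^a+r^b)
    n∸r^b<k : n ∸ r ^ b < k
    n∸r^b<k = m<n+o⇒m∸n<o n (r ^ b)
      (<-≤-trans n<p^a+r^b (subst (_≤ r ^ b + k) (+-comm (r ^ b) (p ^ a))
                                 (+-monoʳ-≤ (r ^ b) (∣⇒≤ p^a∣k))))
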